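{- Let $A$ be a finite nonempty set of positive integers and $p$ a positive integer. Then $w^A(n)=w^A(n+p)$ for all $n\ge0$ (i.e. $w^A$ is periodic over $p$ with no preperiod) if and only if for every $x\in A$ and every integer $0\le m<x$, $w^A(m)=0$ implies $w^A(m+p-x)=1$.
   Context: $w^A:\mathbb{Z}\to\{0,1\}$ is defined by $w^A(n)=1$ for $n<0$ and $w^A(n)=1-\min\{w^A(n-y):y\in A\}$ for $n\ge0$. -}

module Defs where

open import Data.Nat using (ℕ; zero; suc; _∸_; _≤?_)
open import Data.Integer using (ℤ; +_; -[1+_])
open import Data.Bool using (Bool; true; false; not; _∧_)
open import Data.List using (List; []; _∷_)
open import Relation.Nullary using (yes; no)

-- Values are encoded as Bool: true = 1, false = 0.
-- min { w(n - y) : y ∈ A } over the list A (empty min conventionally 1, irrelevant as A ≠ ∅).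
-- For y > n, n - y < 0 so w(n - y) = 1.
-- The fuel argument f bounds the recursion depth; with f > n and all y ∈ A positive
-- every recursive call n - y < n is reached with enough fuel.
mutual
  wFuel : List ℕ → ℕ → ℕ → Bool
  wFuel A zero    n = true
  wFuel A (suc f) n = not (minOver A A f n)

  minOver : List ℕ → List ℕ → ℕ → ℕ → Bool
  minOver A []       f n = true
  minOver A (y ∷ ys) f n with y ≤? n
  ... | yes _ = wFuel A f (n ∸ y) ∧ minOver A ys f n
  ... | no  _ = minOver A ys f n

wℕ : List ℕ → ℕ → Bool
wℕ A n = wFuel A (suc n) n

w : List ℕ → ℤ → Bool
w A (+ n)    = wℕ A n
w A -[1+ n ] = true

-- w^A(n) = 0 exactly when w^A(n - y) = 1 for every y ∈ A with y ≤ n.  If w^A is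
-- p-periodic and w^A(m) = 0, then w^A(m + p) = 0 forces w^A(m + p - x) = 1.
-- Conversely, w^A(n) = w^A(n + p) follows by strong induction on n: the terms
-- n + p - y with y ≤ n are matched with n - y by the induction hypothesis, and the
-- remaining ones (n < y) are exactly what the hypothesis controls, with m = n.
module Submission where

open import Defs
open import Data.Nat as ℕ using (ℕ; suc; _<_; _>_; _∸_; _≤_; _≤?_; s≤s)
open import Data.Nat.Properties using (<-≤-trans; ≤-refl; ≤-trans; ∸-monoʳ-<; +-∸-comm; m≤m+n; ≰⇒>; m<n⇒0<n∸m)
open import Data.Nat.Induction using (<-rec)
open import Data.Integer using (+_; _+_; _-_)
open import Data.Integer.Properties using (m-n≡m⊖n; ⊖-≥; ⊖-<)
open import Data.Bool using (Bool; true; false; not; _∧_)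
open import Data.Bool.Properties using (not-injective; ∧-conicalˡ; ∧-conicalʳ)
open import Data.List using (List; []; _∷_)
open import Data.List.Membership.Propositional using (_∈_)
open import Data.List.Relation.Unary.All as All using (All; []; _∷_)
open import Data.Empty using (⊥-elim)
open import Relation.Binary.PropositionalEquality using (_≡_; _≢_; refl; sym; trans; cong; cong₂)
open import Relation.Nullary using (yes; no)
open import Function.Bundles using (_⇔_; mk⇔; Equivalence)

open Equivalence using (to; from)

∸-<-bound : ∀ {n y f} → 0 < y → y ≤ n → n ≤ f → n ∸ y < f
∸-<-bound 0<y y≤n n≤f = <-≤-trans (∸-monoʳ-< 0<y y≤n) n≤f

≡-from-≡false : ∀ {a b : Bool} → (a ≡ false → b ≡ false) → (b ≡ false → a ≡ false) → a ≡ b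
≡-from-≡false {false} {false} _ _ = refl
≡-from-≡false {false} {true}  f _ = sym (f refl)
≡-from-≡false {true}  {false} _ g = g refl
≡-from-≡false {true}  {true}  _ _ = refl

w-+-∸ : ∀ A {a x} → x ≤ a → w A (+ a - + x) ≡ wℕ A (a ∸ x)
w-+-∸ A {a} {x} x≤a = cong (w A) (trans (m-n≡m⊖n a x) (⊖-≥ x≤a))

w-negative : ∀ A {a x} → a < x → w A (+ a - + x) ≡ true
w-negative A {a} {x} a<x with x ∸ a | m<n⇒0<n∸m a<x | trans (m-n≡m⊖n a x) (⊖-< a<x)
... | suc k | _ | a-x≡-[1+k] = cong (w A) a-x≡-[1+k]

module _ (A : List ℕ) (A⁺ : All (_> 0) A) where

  mutual
    wFuel-stable : ∀ f g n → n < f → n < g → wFuel A f n ≡ wFuel A g n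
    wFuel-stable (suc f) (suc g) n (s≤s n≤f) (s≤s n≤g) =
      cong not (minOver-stable A⁺ f g n n≤f n≤g)

    minOver-stable : ∀ {B} → All (_> 0) B → ∀ f g n → n ≤ f → n ≤ g →
                     minOver A B f n ≡ minOver A B g n
    minOver-stable [] f g n _ _ = refl
    minOver-stable {y ∷ B} (y⁺ ∷ B⁺) f g n n≤f n≤g with y ≤? n
    ... | yes y≤n = cong₂ _∧_ (wFuel-stable f g (n ∸ y) (∸-<-bound y⁺ y≤n n≤f) (∸-<-bound y⁺ y≤n n≤g))
                              (minOver-stable B⁺ f g n n≤f n≤g)
    ... | no  _   = minOver-stable B⁺ f g n n≤f n≤g

  wFuel≡wℕ : ∀ {n y} → 0 < y → y ≤ n → wFuel A n (n ∸ y) ≡ wℕ A (n ∸ y)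
  wFuel≡wℕ {n} {y} y⁺ y≤n = wFuel-stable n (suc (n ∸ y)) (n ∸ y) (∸-<-bound y⁺ y≤n ≤-refl) ≤-refl

  minOver≡true⇔ : ∀ {B} → All (_> 0) B → ∀ n →
                  minOver A B n n ≡ true ⇔ All (λ y → y ≤ n → wℕ A (n ∸ y) ≡ true) B
  minOver≡true⇔ [] n = mk⇔ (λ _ → []) (λ _ → refl)
  minOver≡true⇔ {y ∷ B} (y⁺ ∷ B⁺) n with y ≤? n | minOver≡true⇔ B⁺ n
  ... | yes y≤n | ih = mk⇔
    (λ e → (λ _ → trans (sym (wFuel≡wℕ y⁺ y≤n)) (∧-conicalˡ _ _ e)) ∷ to ih (∧-conicalʳ _ _ e))
    (λ { (h ∷ hs) → cong₂ _∧_ (trans (wFuel≡wℕ y⁺ y≤n) (h y≤n)) (from ih hs) })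
  ... | no  y≰n | ih = mk⇔
    (λ e → (λ y≤n → ⊥-elim (y≰n y≤n)) ∷ to ih e)
    (λ { (_ ∷ hs) → from ih hs })

  wℕ≡false⇔ : ∀ n → wℕ A n ≡ false ⇔ (∀ y → y ∈ A → y ≤ n → wℕ A (n ∸ y) ≡ true)
  wℕ≡false⇔ n = mk⇔ (λ e y → All.lookup (to minOver⇔ (not-injective e)))
                     (λ h → cong not (from minOver⇔ (All.tabulate (h _))))
    where
    minOver⇔ : minOver A A n n ≡ true ⇔ All (λ y → y ≤ n → wℕ A (n ∸ y) ≡ true) A
    minOver⇔ = minOver≡true⇔ A⁺ n

  module _ (p : ℕ) where

    Periodic : Set
    Periodic = ∀ (n : ℕ) → w A (+ n) ≡ w A (+ n + + p)

    PeriodicAt : ℕ → Set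
    PeriodicAt m = wℕ A m ≡ wℕ A (m ℕ.+ p)

    PeriodicAtPredecessors : ℕ → Set
    PeriodicAtPredecessors n = ∀ {y} → y ∈ A → y ≤ n → PeriodicAt (n ∸ y)

    ZerosShiftToOnes : Set
    ZerosShiftToOnes = ∀ (x : ℕ) → x ∈ A → ∀ (m : ℕ) → m < x →
                       w A (+ m) ≡ false → w A (+ m + + p - + x) ≡ true

    periodic⇒zerosShiftToOnes : Periodic → ZerosShiftToOnes
    periodic⇒zerosShiftToOnes periodic x x∈A m _ wm≡0 with x ≤? m ℕ.+ p
    ... | yes x≤m+p = trans (w-+-∸ A x≤m+p)
                            (to (wℕ≡false⇔ (m ℕ.+ p)) (trans (sym (periodic m)) wm≡0) x x∈A x≤m+p)
    ... | no  x≰m+p = w-negative A (≰⇒> x≰m+p)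

    shift-zero⇒zero : ∀ n → PeriodicAtPredecessors n → wℕ A (n ℕ.+ p) ≡ false → wℕ A n ≡ false
    shift-zero⇒zero n ih wn+p≡0 = from (wℕ≡false⇔ n) λ y y∈A y≤n →
      trans (ih y∈A y≤n)
            (trans (cong (wℕ A) (sym (+-∸-comm p y≤n)))
                   (to (wℕ≡false⇔ (n ℕ.+ p)) wn+p≡0 y y∈A (≤-trans y≤n (m≤m+n n p))))

    zero⇒shift-zero : ZerosShiftToOnes → ∀ n → PeriodicAtPredecessors n → wℕ A n ≡ false → wℕ A (n ℕ.+ p) ≡ false
    zero⇒shift-zero cond n ih wn≡0 = from (wℕ≡false⇔ (n ℕ.+ p)) shifted-one
      where
      shifted-one : ∀ y → y ∈ A → y ≤ n ℕ.+ p → wℕ A (n ℕ.+ p ∸ y) ≡ true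
      shifted-one y y∈A y≤n+p with y ≤? n
      ... | yes y≤n = trans (cong (wℕ A) (+-∸-comm p y≤n))
                            (trans (sym (ih y∈A y≤n)) (to (wℕ≡false⇔ n) wn≡0 y y∈A y≤n))
      ... | no  y≰n = trans (sym (w-+-∸ A y≤n+p)) (cond y y∈A n (≰⇒> y≰n) wn≡0)

    zerosShiftToOnes⇒periodic : ZerosShiftToOnes → Periodic
    zerosShiftToOnes⇒periodic cond = <-rec _ λ n rec →
      let ih : PeriodicAtPredecessors n
          ih y∈A y≤n = rec (∸-<-bound (All.lookup A⁺ y∈A) y≤n ≤-refl)
      in ≡-from-≡false (zero⇒shift-zero cond n ih) (shift-zero⇒zero n ih)

lemma2p16 : (A : List ℕ) → A ≢ [] → All (λ x → x > 0) A → (p : ℕ) → p > 0 →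
    ((∀ (n : ℕ) → w A (+ n) ≡ w A (+ n + + p))
      ⇔ (∀ (x : ℕ) → x ∈ A → ∀ (m : ℕ) → m < x →
           w A (+ m) ≡ false → w A (+ m + + p - + x) ≡ true))
lemma2p16 A _ A⁺ p _ = mk⇔ (periodic⇒zerosShiftToOnes A A⁺ p) (zerosShiftToOnes⇒periodic A A⁺ p)
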